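{- Suppose we have $\underline{\Gamma};\Delta,x:\tau,\Delta'\vdash t:\sigma$ and $\underline{\Gamma};\Delta''\vdash u:\tau$. Then we have $[\![t[u/x]]\!]\le[\![t]\!]\circ(\mathrm{id}_{[\![\Delta]\!]}\otimes[\![u]\!]\otimes\mathrm{id}_{[\![\Delta']\!]})$, as morphisms $[\![\Delta,\Delta'',\Delta']\!]\to[\![\sigma]\!]$.
   Context: Let $\mathcal{C}$ be a strict monoidal closed category, not necessarily symmetric, with the following structure. - Enrichment: $\mathcal{C}$ is enriched in posets, so hom-sets are posets and composition, $\otimes$ and currying $\Lambda_{X,Y,Z}:\mathrm{Hom}(X\otimes Y,Z)\cong\mathrm{Hom}(X,Y\multimap Z)$ are monotone. - Closed structure: $\mathrm{ev}_{Y,Z}:(Y\multimap Z)\otimes Y\to Z$ denotes evaluation. - Bottom maps: there are least elements $\bot_X\in\mathrm{Hom}(X,I)$, where $I$ is the tensor unit, with $\bot_X\otimes\bot_Y=\bot_{X\otimes Y}$ and $\bot_I=\mathrm{id}_I$. Consider purely affine planar $\lambda$-terms: types are built from a base type $\mathtt{o}$ with $\multimap$. Judgements have the form $\underline{\Gamma};\Delta\vdash t:\tau$, with $\underline{\Gamma}$ a signature of duplicable constants and $\Delta$ an ordered list of affine variables. The typing rules are: - constant rule: $\underline{\Gamma};\Delta\vdash x:\tau$ for $x:\tau$ in $\underline{\Gamma}$; - variable rule: $\underline{\Gamma};\Delta,x:\tau,\Delta'\vdash x:\tau$; - abstraction: from $\Delta,x:\tau\vdash t:\sigma$ infer $\Delta\vdash\lambda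 x.t:\tau\multimap\sigma$; - application: from $\Delta\vdash t:\tau\multimap\sigma$ and $\Delta'\vdash u:\tau$ infer $\Delta,\Delta'\vdash t\,u:\sigma$. $t[u/x]$ denotes capture-avoiding substitution. Given an object $[\![\mathtt{o}]\!]$ and morphisms $[\![x]\!]:I\to[\![\tau]\!]$ for constants, terms are interpreted as follows: - types: $[\![\tau\multimap\sigma]\!]=[\![\tau]\!]\multimap[\![\sigma]\!]$; - contexts: $[\![\cdot]\!]=I$ and $[\![\Delta,x:\tau]\!]=[\![\Delta]\!]\otimes[\![\tau]\!]$; - constant $\mapsto[\![x]\!]\circ\bot_{[\![\Delta]\!]}$; - variable $\mapsto\bot_{[\![\Delta]\!]}\otimes\mathrm{id}_{[\![\tau]\!]}\otimes\bot_{[\![\Delta']\!]}$; - abstraction $\mapsto\Lambda([\![t]\!])$; - application $\mapsto\mathrm{ev}\circ([\![t]\!]\otimes[\![u]\!])$. -}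

module Defs where

open import Level using (Level; _⊔_) renaming (suc to lsuc)
open import Data.List using (List)
open import Data.List.Membership.Propositional using (_∈_)
open import Data.Product using (Σ; _×_; _,_)
open import Data.Sum using (_⊎_; inj₁; inj₂)
open import Relation.Binary.PropositionalEquality
open import Relation.Binary.Structures using (IsPartialOrder)

-- Strictness: the monoidal structure is a strict
-- monoid on objects (propositional equalities, transported on
-- morphisms with subst₂ Hom).

record PosMonClosed (o ℓ e : Level) : Set (lsuc (o ⊔ ℓ ⊔ e)) where
  infixr 9 _∘_
  infixl 10 _⊗₀_ _⊗₁_
  infixr 8 _⊸_
  field
    Obj  : Set o
    Hom  : Obj → Obj → Set ℓ
    id   : ∀ {X} → Hom X X
    _∘_  : ∀ {X Y Z} → Hom Y Z → Hom X Y → Hom X Z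
    idˡ  : ∀ {X Y} (f : Hom X Y) → id ∘ f ≡ f
    idʳ  : ∀ {X Y} (f : Hom X Y) → f ∘ id ≡ f
    ∘-assoc : ∀ {W X Y Z} (f : Hom Y Z) (g : Hom X Y) (h : Hom W X) →
              (f ∘ g) ∘ h ≡ f ∘ (g ∘ h)

    _≤_  : ∀ {X Y} → Hom X Y → Hom X Y → Set e
    ≤-isPartialOrder : ∀ {X Y} → IsPartialOrder (_≡_ {A = Hom X Y}) _≤_
    ∘-mono : ∀ {X Y Z} {f f' : Hom Y Z} {g g' : Hom X Y} →
             f ≤ f' → g ≤ g' → (f ∘ g) ≤ (f' ∘ g')

    I    : Obj
    _⊗₀_ : Obj → Obj → Obj
    _⊗₁_ : ∀ {X X' Y Y'} → Hom X X' → Hom Y Y' → Hom (X ⊗₀ Y) (X' ⊗₀ Y')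
    ⊗-id : ∀ {X Y} → (id {X}) ⊗₁ (id {Y}) ≡ id
    ⊗-∘  : ∀ {X X' X'' Y Y' Y''} (f : Hom X' X'') (g : Hom X X')
             (h : Hom Y' Y'') (k : Hom Y Y') →
           (f ∘ g) ⊗₁ (h ∘ k) ≡ (f ⊗₁ h) ∘ (g ⊗₁ k)
    ⊗-mono : ∀ {X X' Y Y'} {f f' : Hom X X'} {g g' : Hom Y Y'} →
             f ≤ f' → g ≤ g' → (f ⊗₁ g) ≤ (f' ⊗₁ g')
    assoc₀ : ∀ X Y Z → (X ⊗₀ Y) ⊗₀ Z ≡ X ⊗₀ (Y ⊗₀ Z)
    unitˡ₀ : ∀ X → I ⊗₀ X ≡ X
    unitʳ₀ : ∀ X → X ⊗₀ I ≡ X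
    assoc₁ : ∀ {X X' Y Y' Z Z'} (f : Hom X X') (g : Hom Y Y') (h : Hom Z Z') →
             subst₂ Hom (assoc₀ X Y Z) (assoc₀ X' Y' Z') ((f ⊗₁ g) ⊗₁ h)
               ≡ f ⊗₁ (g ⊗₁ h)
    unitˡ₁ : ∀ {X Y} (f : Hom X Y) →
             subst₂ Hom (unitˡ₀ X) (unitˡ₀ Y) (id {I} ⊗₁ f) ≡ f
    unitʳ₁ : ∀ {X Y} (f : Hom X Y) →
             subst₂ Hom (unitʳ₀ X) (unitʳ₀ Y) (f ⊗₁ id {I}) ≡ f

    _⊸_ : Obj → Obj → Obj
    ev  : ∀ {Y Z} → Hom ((Y ⊸ Z) ⊗₀ Y) Z
    Λ   : ∀ {X Y Z} → Hom (X ⊗₀ Y) Z → Hom X (Y ⊸ Z)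
    β   : ∀ {X Y Z} (f : Hom (X ⊗₀ Y) Z) → ev ∘ (Λ f ⊗₁ id) ≡ f
    η   : ∀ {X Y Z} (g : Hom X (Y ⊸ Z)) → Λ (ev ∘ (g ⊗₁ id)) ≡ g
    Λ-mono : ∀ {X Y Z} {f f' : Hom (X ⊗₀ Y) Z} → f ≤ f' → Λ f ≤ Λ f'

    ⊥      : ∀ X → Hom X I
    ⊥-least : ∀ {X} (f : Hom X I) → ⊥ X ≤ f
    ⊥-⊗    : ∀ X Y → subst (Hom (X ⊗₀ Y)) (unitˡ₀ I) (⊥ X ⊗₁ ⊥ Y) ≡ ⊥ (X ⊗₀ Y)
    ⊥-I    : ⊥ I ≡ id

-- Types, contexts (snoc lists, Δ ▸ τ is Δ , x : τ)

infixr 30 _⇒_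
data Ty : Set where
  o   : Ty
  _⇒_ : Ty → Ty → Ty

infixl 20 _▸_
data Ctx : Set where
  ε   : Ctx
  _▸_ : Ctx → Ty → Ctx

infixl 15 _++_
_++_ : Ctx → Ctx → Ctx
Δ ++ ε       = Δ
Δ ++ (Δ' ▸ τ) = (Δ ++ Δ') ▸ τ

++-assoc : ∀ A B C → (A ++ B) ++ C ≡ A ++ (B ++ C)
++-assoc A B ε       = refl
++-assoc A B (C ▸ τ) = cong (_▸ τ) (++-assoc A B C)

++-identityˡ : ∀ A → ε ++ A ≡ A
++-identityˡ ε       = refl
++-identityˡ (A ▸ τ) = cong (_▸ τ) (++-identityˡ A)

▸-injˡ : ∀ {A B a b} → A ▸ a ≡ B ▸ b → A ≡ B
▸-injˡ refl = refl

▸-injʳ : ∀ {A B a b} → A ▸ a ≡ B ▸ b → a ≡ b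
▸-injʳ refl = refl

split : ∀ A B C D → A ++ B ≡ C ++ D →
        (Σ Ctx λ E → A ≡ C ++ E × D ≡ E ++ B) ⊎
        (Σ Ctx λ E → C ≡ A ++ E × B ≡ E ++ D)
split A ε C D eq = inj₁ (D , eq , refl)
split A (B ▸ b) C ε eq = inj₂ (B ▸ b , sym eq , refl)
split A (B ▸ b) C (D ▸ d) eq with split A B C D (▸-injˡ eq) | ▸-injʳ eq
... | inj₁ (E , p , q) | refl = inj₁ (E , p , cong (_▸ b) q)
... | inj₂ (E , p , q) | refl = inj₂ (E , p , cong (_▸ b) q)

-- Purely affine planar terms, intrinsically typed (typing derivations)
-- over a signature Γ of duplicable constants.

data Tm (Γ : List Ty) (Θ : Ctx) : Ty → Set where
  cst : ∀ {τ} → τ ∈ Γ → Tm Γ Θ τ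
  var : ∀ {τ} (Δ Δ' : Ctx) → Θ ≡ (Δ ▸ τ) ++ Δ' → Tm Γ Θ τ
  lam : ∀ {τ σ} → Tm Γ (Θ ▸ τ) σ → Tm Γ Θ (τ ⇒ σ)
  app : ∀ {τ σ} (Δ Δ' : Ctx) → Θ ≡ Δ ++ Δ' →
        Tm Γ Δ (τ ⇒ σ) → Tm Γ Δ' τ → Tm Γ Θ σ

castTm : ∀ {Γ Θ Θ' σ} → Θ ≡ Θ' → Tm Γ Θ σ → Tm Γ Θ' σ
castTm refl t = t

wk : ∀ {Γ Θ σ} (A B M : Ctx) → Θ ≡ A ++ B → Tm Γ Θ σ → Tm Γ ((A ++ M) ++ B) σ
wk A B M eq (cst c) = cst c
wk {σ = τ} A B M eq (var Δ Δ' refl) with split (Δ ▸ τ) Δ' A B eq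
... | inj₁ (ε , refl , refl) = var Δ (M ++ (ε ++ Δ')) (++-assoc (Δ ▸ τ) M (ε ++ Δ'))
... | inj₁ (E ▸ ρ , refl , refl) = var ((A ++ M) ++ E) Δ' (sym (++-assoc (A ++ M) (E ▸ ρ) Δ'))
... | inj₂ (E , refl , refl) =
  var Δ ((E ++ M) ++ B)
    (trans (cong (_++ B) (++-assoc (Δ ▸ τ) E M)) (++-assoc (Δ ▸ τ) (E ++ M) B))
wk A B M eq (lam t) = lam (wk A (B ▸ _) M (cong (_▸ _) eq) t)
wk A B M eq (app Δ₁ Δ₂ refl t u) with split Δ₁ Δ₂ A B eq
... | inj₁ (E , refl , refl) =
  app ((A ++ M) ++ E) Δ₂ (sym (++-assoc (A ++ M) E Δ₂)) (wk A E M refl t) u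
... | inj₂ (E , refl , refl) =
  app Δ₁ ((E ++ M) ++ B)
    (trans (cong (_++ B) (++-assoc Δ₁ E M)) (++-assoc Δ₁ (E ++ M) B))
    t (wk E B M refl u)

wk₂ : ∀ {Γ Θ σ} (L R : Ctx) → Tm Γ Θ σ → Tm Γ ((L ++ Θ) ++ R) σ
wk₂ {Θ = Θ} L R u =
  wk (L ++ Θ) ε R refl
     (castTm (cong (_++ Θ) (++-identityˡ L)) (wk ε Θ L (sym (++-identityˡ Θ)) u))

sub : ∀ {Γ Θ σ τ Δ''} (Δ Δ' : Ctx) → Θ ≡ (Δ ▸ τ) ++ Δ' →
      Tm Γ Θ σ → Tm Γ Δ'' τ → Tm Γ ((Δ ++ Δ'') ++ Δ') σ
sub Δ Δ' eq (cst c) u = cst c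
sub {σ = σ} {τ} {Δ''} Δ Δ' eq (var Δ₁ Δ₂ refl) u with split (Δ₁ ▸ σ) Δ₂ (Δ ▸ τ) Δ' eq
... | inj₁ (ε , refl , refl) = wk₂ Δ (ε ++ Δ₂) u
... | inj₁ (E ▸ ρ , refl , refl) = var ((Δ ++ Δ'') ++ E) Δ₂ (sym (++-assoc (Δ ++ Δ'') (E ▸ ρ) Δ₂))
... | inj₂ (ε , refl , refl) = wk₂ Δ Δ' u
... | inj₂ (E ▸ ρ , refl , refl) =
  var Δ₁ ((E ++ Δ'') ++ Δ')
    (trans (cong (_++ Δ') (++-assoc (Δ₁ ▸ σ) E Δ'')) (++-assoc (Δ₁ ▸ σ) (E ++ Δ'') Δ'))
sub Δ Δ' eq (lam t) u = lam (sub Δ (Δ' ▸ _) (cong (_▸ _) eq) t u)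
sub {τ = τ} {Δ''} Δ Δ' eq (app Δ₁ Δ₂ refl t₁ t₂) u with split Δ₁ Δ₂ (Δ ▸ τ) Δ' eq
... | inj₁ (E , q , refl) =
  app ((Δ ++ Δ'') ++ E) Δ₂ (sym (++-assoc (Δ ++ Δ'') E Δ₂)) (sub Δ E q t₁ u) t₂
... | inj₂ (ε , q , refl) =
  app (Δ ++ Δ'') (ε ++ Δ') (cong ((Δ ++ Δ'') ++_) (sym (++-identityˡ Δ')))
      (sub Δ ε (sym q) t₁ u) t₂
... | inj₂ (E ▸ ρ , refl , r) =
  app Δ₁ ((E ++ Δ'') ++ Δ')
    (trans (cong (_++ Δ') (++-assoc Δ₁ E Δ'')) (++-assoc Δ₁ (E ++ Δ'') Δ'))
    t₁ (sub E Δ' r t₂ u)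

module Interp {c ℓ e : Level} (𝒞 : PosMonClosed c ℓ e) (⟦o⟧ : PosMonClosed.Obj 𝒞)
              (Γ : List Ty) where
  open PosMonClosed 𝒞

  ⟦_⟧ty : Ty → Obj
  ⟦ o ⟧ty     = ⟦o⟧
  ⟦ τ ⇒ σ ⟧ty = ⟦ τ ⟧ty ⊸ ⟦ σ ⟧ty

  ⟦_⟧ctx : Ctx → Obj
  ⟦ ε ⟧ctx     = I
  ⟦ Δ ▸ τ ⟧ctx = ⟦ Δ ⟧ctx ⊗₀ ⟦ τ ⟧ty

  ⟦++⟧ : ∀ A B → ⟦ A ++ B ⟧ctx ≡ ⟦ A ⟧ctx ⊗₀ ⟦ B ⟧ctx
  ⟦++⟧ A ε       = sym (unitʳ₀ ⟦ A ⟧ctx)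
  ⟦++⟧ A (B ▸ b) = trans (cong (_⊗₀ ⟦ b ⟧ty) (⟦++⟧ A B)) (assoc₀ ⟦ A ⟧ctx ⟦ B ⟧ctx ⟦ b ⟧ty)

  cast : ∀ {X X' Y Y'} → X ≡ X' → Y ≡ Y' → Hom X Y → Hom X' Y'
  cast = subst₂ Hom

  module Terms (⟦_⟧c : ∀ {τ} → τ ∈ Γ → Hom I ⟦ τ ⟧ty) where
    ⟦_⟧ : ∀ {Θ σ} → Tm Γ Θ σ → Hom ⟦ Θ ⟧ctx ⟦ σ ⟧ty
    ⟦_⟧ {Θ} (cst c) = ⟦ c ⟧c ∘ ⊥ ⟦ Θ ⟧ctx
    ⟦_⟧ {σ = τ} (var Δ Δ' p) =
      cast (sym (trans (cong ⟦_⟧ctx p) (⟦++⟧ (Δ ▸ τ) Δ')))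
           (trans (unitʳ₀ (I ⊗₀ ⟦ τ ⟧ty)) (unitˡ₀ ⟦ τ ⟧ty))
           ((⊥ ⟦ Δ ⟧ctx ⊗₁ id) ⊗₁ ⊥ ⟦ Δ' ⟧ctx)
    ⟦ lam t ⟧ = Λ ⟦ t ⟧
    ⟦ app Δ Δ' p t u ⟧ =
      cast (sym (trans (cong ⟦_⟧ctx p) (⟦++⟧ Δ Δ'))) refl (ev ∘ (⟦ t ⟧ ⊗₁ ⟦ u ⟧))

module Submission where

-- Induction on t, proving ⟦ t[u/x] ⟧ ≤ ⟦ t ⟧ ∘ R not only for
-- R = (id ⊗ ⟦ u ⟧) ⊗ id but for every R equal to it up to strictness, so that
-- the λ case can pass R ⊗ id to the body (by naturality of Λ) and the
-- application case can split R along the two subterms (by functoriality of ⊗).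
-- A constant or a variable other than x sees R only through bottom maps, and
-- ⊥ ≤ ⊥ ∘ h by leastness.  At x itself, t[u/x] is u weakened on both sides,
-- and the same induction for weakening, with ⊥ in place of ⟦ u ⟧, bounds it
-- by (⊥ ⊗ ⟦ u ⟧) ⊗ ⊥ = ((⊥ ⊗ id) ⊗ ⊥) ∘ ((id ⊗ ⟦ u ⟧) ⊗ id).

open import Defs
open import Level using (Level; _⊔_)
open import Data.List using (List)
open import Data.List.Membership.Propositional using (_∈_)
open import Data.Product using (_,_)
open import Data.Sum using (inj₁; inj₂)
open import Relation.Binary.PropositionalEquality
  using (_≡_; refl; sym; trans; cong; cong₂; subst₂; module ≡-Reasoning)
open import Relation.Binary.Structures using (IsPartialOrder)

module Transport {c ℓ e : Level} (𝒞 : PosMonClosed c ℓ e) where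
  open PosMonClosed 𝒞
  private
    module ≤ {X Y : Obj} = IsPartialOrder (≤-isPartialOrder {X} {Y})

  infix 4 _≅_ _≲_

  -- The monoidal structure is strict only up to propositional equality of
  -- objects, so morphisms are compared across equal types: f ≅ g (f ≲ g) says
  -- that f, transported to the type of g, is equal to (below) g.
  data _≅_ {X Y : Obj} (f : Hom X Y) : ∀ {X' Y'} → Hom X' Y' → Set ℓ where
    ≅-refl : f ≅ f

  data _≲_ {X Y : Obj} (f : Hom X Y) : ∀ {X' Y'} → Hom X' Y' → Set (ℓ ⊔ e) where
    ≤⇒≲ : ∀ {g} → f ≤ g → f ≲ g

  ≲⇒≤ : ∀ {X Y} {f g : Hom X Y} → f ≲ g → f ≤ g
  ≲⇒≤ (≤⇒≲ p) = p

  ≡⇒≅ : ∀ {X Y} {f g : Hom X Y} → f ≡ g → f ≅ g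
  ≡⇒≅ refl = ≅-refl

  module _ {X Y X' Y'} {f : Hom X Y} {g : Hom X' Y'} where
    ≅-sym : f ≅ g → g ≅ f
    ≅-sym ≅-refl = ≅-refl

    ≅⇒≲ : f ≅ g → f ≲ g
    ≅⇒≲ ≅-refl = ≤⇒≲ ≤.refl

  module _ {X Y X' Y' X'' Y''} {f : Hom X Y} {g : Hom X' Y'} {h : Hom X'' Y''} where
    ≅-trans : f ≅ g → g ≅ h → f ≅ h
    ≅-trans ≅-refl q = q

    ≅-≲-trans : f ≅ g → g ≲ h → f ≲ h
    ≅-≲-trans ≅-refl q = q

    ≲-≅-trans : f ≲ g → g ≅ h → f ≲ h
    ≲-≅-trans p ≅-refl = p

    ≲-trans : f ≲ g → g ≲ h → f ≲ h
    ≲-trans (≤⇒≲ p) (≤⇒≲ q) = ≤⇒≲ (≤.trans p q)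

  cast-≅ : ∀ {X Y X' Y'} (p : X ≡ X') (q : Y ≡ Y') (f : Hom X Y) → subst₂ Hom p q f ≅ f
  cast-≅ refl refl f = ≅-refl

  id-cong : ∀ {X X'} → X ≡ X' → id {X} ≅ id {X'}
  id-cong refl = ≅-refl

  ⊥-cong : ∀ {X X'} → X ≡ X' → ⊥ X ≅ ⊥ X'
  ⊥-cong refl = ≅-refl

  module _ {X Y Z X' Y' Z'} {f : Hom Y Z} {g : Hom X Y} {f' : Hom Y' Z'} {g' : Hom X' Y'} where
    ∘-cong : f ≅ f' → g ≅ g' → f ∘ g ≅ f' ∘ g'
    ∘-cong ≅-refl ≅-refl = ≅-refl

    ∘-mono-≲ : f ≲ f' → g ≲ g' → f ∘ g ≲ f' ∘ g'
    ∘-mono-≲ (≤⇒≲ p) (≤⇒≲ q) = ≤⇒≲ (∘-mono p q)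

  module _ {X Y Z W X' Y' Z' W'} {f : Hom X Y} {g : Hom Z W} {f' : Hom X' Y'} {g' : Hom Z' W'} where
    ⊗-cong : f ≅ f' → g ≅ g' → f ⊗₁ g ≅ f' ⊗₁ g'
    ⊗-cong ≅-refl ≅-refl = ≅-refl

    ⊗-mono-≲ : f ≲ f' → g ≲ g' → f ⊗₁ g ≲ f' ⊗₁ g'
    ⊗-mono-≲ (≤⇒≲ p) (≤⇒≲ q) = ≤⇒≲ (⊗-mono p q)

  module ≅-Reasoning where
    infix  1 begin_
    infixr 2 _≅⟨_⟩_ _≅˘⟨_⟩_
    infix  3 _∎

    begin_ : ∀ {X Y X' Y'} {f : Hom X Y} {g : Hom X' Y'} → f ≅ g → f ≅ g
    begin p = p

    _≅⟨_⟩_ : ∀ {X Y X' Y' X'' Y''} (f : Hom X Y) {g : Hom X' Y'} {h : Hom X'' Y''} →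
             f ≅ g → g ≅ h → f ≅ h
    f ≅⟨ p ⟩ q = ≅-trans p q

    _≅˘⟨_⟩_ : ∀ {X Y X' Y' X'' Y''} (f : Hom X Y) {g : Hom X' Y'} {h : Hom X'' Y''} →
              g ≅ f → g ≅ h → f ≅ h
    f ≅˘⟨ p ⟩ q = ≅-trans (≅-sym p) q

    _∎ : ∀ {X Y} (f : Hom X Y) → f ≅ f
    f ∎ = ≅-refl

  module ≲-Reasoning where
    infix  1 begin_
    infixr 2 _≲⟨_⟩_ _≅⟨_⟩_ _≅˘⟨_⟩_
    infix  3 _∎

    begin_ : ∀ {X Y X' Y'} {f : Hom X Y} {g : Hom X' Y'} → f ≲ g → f ≲ g
    begin p = p

    _≲⟨_⟩_ : ∀ {X Y X' Y' X'' Y''} (f : Hom X Y) {g : Hom X' Y'} {h : Hom X'' Y''} →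
             f ≲ g → g ≲ h → f ≲ h
    f ≲⟨ p ⟩ q = ≲-trans p q

    _≅⟨_⟩_ : ∀ {X Y X' Y' X'' Y''} (f : Hom X Y) {g : Hom X' Y'} {h : Hom X'' Y''} →
             f ≅ g → g ≲ h → f ≲ h
    f ≅⟨ p ⟩ q = ≅-≲-trans p q

    _≅˘⟨_⟩_ : ∀ {X Y X' Y' X'' Y''} (f : Hom X Y) {g : Hom X' Y'} {h : Hom X'' Y''} →
              g ≅ f → g ≲ h → f ≲ h
    f ≅˘⟨ p ⟩ q = ≅-≲-trans (≅-sym p) q

    _∎ : ∀ {X Y} (f : Hom X Y) → f ≲ f
    f ∎ = ≅⇒≲ ≅-refl

module Monoidal {c ℓ e : Level} (𝒞 : PosMonClosed c ℓ e) where
  open PosMonClosed 𝒞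
  open Transport 𝒞

  assoc-≅ : ∀ {X X' Y Y' Z Z'} (f : Hom X X') (g : Hom Y Y') (h : Hom Z Z') →
            (f ⊗₁ g) ⊗₁ h ≅ f ⊗₁ (g ⊗₁ h)
  assoc-≅ f g h = ≅-trans (≅-sym (cast-≅ _ _ _)) (≡⇒≅ (assoc₁ f g h))

  unitˡ-≅ : ∀ {X Y} (f : Hom X Y) → id {I} ⊗₁ f ≅ f
  unitˡ-≅ f = ≅-trans (≅-sym (cast-≅ _ _ _)) (≡⇒≅ (unitˡ₁ f))

  unitʳ-≅ : ∀ {X Y} (f : Hom X Y) → f ⊗₁ id {I} ≅ f
  unitʳ-≅ f = ≅-trans (≅-sym (cast-≅ _ _ _)) (≡⇒≅ (unitʳ₁ f))

  ⊗-id-≅ : ∀ {X Y} → id {X} ⊗₁ id {Y} ≅ id {X ⊗₀ Y}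
  ⊗-id-≅ = ≡⇒≅ ⊗-id

  ⊗₃-∘ : ∀ {X X' X'' Y Y' Y'' Z Z' Z''} (f : Hom X' X'') (f' : Hom X X')
           (g : Hom Y' Y'') (g' : Hom Y Y') (h : Hom Z' Z'') (h' : Hom Z Z') →
         ((f ⊗₁ g) ⊗₁ h) ∘ ((f' ⊗₁ g') ⊗₁ h') ≡ ((f ∘ f') ⊗₁ (g ∘ g')) ⊗₁ (h ∘ h')
  ⊗₃-∘ f f' g g' h h' = trans (sym (⊗-∘ _ _ _ _)) (cong (_⊗₁ (h ∘ h')) (sym (⊗-∘ _ _ _ _)))

  ⊗-idʳ-assoc : ∀ {X Y} (f : Hom X Y) {B S} → (f ⊗₁ id {B}) ⊗₁ id {S} ≅ f ⊗₁ id {B ⊗₀ S}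
  ⊗-idʳ-assoc f = ≅-trans (assoc-≅ f id id) (⊗-cong ≅-refl ⊗-id-≅)

  ⊗-idʳ-split : ∀ {X Y Z P Q P' Q' P'' Q''} {f : Hom P Q} {R : Hom P' Q'} {R' : Hom P'' Q''} →
                R ≅ f ⊗₁ id {X} → X ≡ Y ⊗₀ Z → R' ≅ f ⊗₁ id {Y} → R ≅ R' ⊗₁ id {Z}
  ⊗-idʳ-split {f = f} R≅ refl R'≅ =
    ≅-trans R≅ (≅-trans (≅-sym (⊗-idʳ-assoc f)) (⊗-cong (≅-sym R'≅) ≅-refl))

  ⊗-idˡ-split : ∀ {X V W B P Q P' Q' P'' Q''} {m : Hom P Q} {R : Hom P' Q'} {R' : Hom P'' Q''} →
                R ≅ (id {X} ⊗₁ m) ⊗₁ id {B} → X ≡ V ⊗₀ W → R' ≅ (id {W} ⊗₁ m) ⊗₁ id {B} →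
                R ≅ id {V} ⊗₁ R'
  ⊗-idˡ-split {m = m} {R} {R'} R≅ refl R'≅ = begin
    R                          ≅⟨ R≅ ⟩
    (id ⊗₁ m) ⊗₁ id            ≅˘⟨ ⊗-cong (⊗-cong ⊗-id-≅ ≅-refl) ≅-refl ⟩
    ((id ⊗₁ id) ⊗₁ m) ⊗₁ id    ≅⟨ ⊗-cong (assoc-≅ id id m) ≅-refl ⟩
    (id ⊗₁ (id ⊗₁ m)) ⊗₁ id    ≅⟨ assoc-≅ id (id ⊗₁ m) id ⟩
    id ⊗₁ ((id ⊗₁ m) ⊗₁ id)    ≅˘⟨ ⊗-cong ≅-refl R'≅ ⟩
    id ⊗₁ R'                   ∎
    where open ≅-Reasoning

  Λ-natural : ∀ {X X' Y Z} (g : Hom (X ⊗₀ Y) Z) (h : Hom X' X) → Λ g ∘ h ≡ Λ (g ∘ (h ⊗₁ id))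
  Λ-natural g h = begin
    Λ g ∘ h                              ≡⟨ sym (η _) ⟩
    Λ (ev ∘ ((Λ g ∘ h) ⊗₁ id))           ≡⟨ cong (λ k → Λ (ev ∘ ((Λ g ∘ h) ⊗₁ k))) (sym (idˡ id)) ⟩
    Λ (ev ∘ ((Λ g ∘ h) ⊗₁ (id ∘ id)))    ≡⟨ cong (λ k → Λ (ev ∘ k)) (⊗-∘ _ _ _ _) ⟩
    Λ (ev ∘ ((Λ g ⊗₁ id) ∘ (h ⊗₁ id)))   ≡⟨ cong Λ (sym (∘-assoc _ _ _)) ⟩
    Λ ((ev ∘ (Λ g ⊗₁ id)) ∘ (h ⊗₁ id))   ≡⟨ cong (λ k → Λ (k ∘ (h ⊗₁ id))) (β g) ⟩
    Λ (g ∘ (h ⊗₁ id))                    ∎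
    where open ≡-Reasoning

  idˡ-factor : ∀ {X Y} (f : Hom X Y) → f ≲ id ∘ f
  idˡ-factor f = ≅⇒≲ (≡⇒≅ (sym (idˡ f)))

  idʳ-factor : ∀ {X Y} (f : Hom X Y) → f ≲ f ∘ id
  idʳ-factor f = ≅⇒≲ (≡⇒≅ (sym (idʳ f)))

  ⊥-factor : ∀ {X Y} (h : Hom X Y) → ⊥ X ≲ ⊥ Y ∘ h
  ⊥-factor h = ≤⇒≲ (⊥-least _)

  ⊗-factor : ∀ {X X' Y Y' Z Z' P P' Q Q'} {f : Hom P Q} {f' : Hom P' Q'}
               {g : Hom Y Z} {h : Hom X Y} {g' : Hom Y' Z'} {h' : Hom X' Y'} →
             f ≲ g ∘ h → f' ≲ g' ∘ h' → f ⊗₁ f' ≲ (g ⊗₁ g') ∘ (h ⊗₁ h')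
  ⊗-factor p q = ≲-≅-trans (⊗-mono-≲ p q) (≡⇒≅ (⊗-∘ _ _ _ _))

  ∘-factor : ∀ {X Y Z W P} (k : Hom Z W) {f : Hom P Z} {g : Hom Y Z} {h : Hom X Y} →
             f ≲ g ∘ h → k ∘ f ≲ (k ∘ g) ∘ h
  ∘-factor k p = ≲-≅-trans (∘-mono-≲ (≅⇒≲ ≅-refl) p) (≡⇒≅ (sym (∘-assoc _ _ _)))

  Λ-factor : ∀ {X X' Y Z} {f : Hom (X' ⊗₀ Y) Z} {g : Hom (X ⊗₀ Y) Z} {h : Hom X' X} →
             f ≲ g ∘ (h ⊗₁ id) → Λ f ≲ Λ g ∘ h
  Λ-factor {g = g} {h} p = ≲-≅-trans (≤⇒≲ (Λ-mono (≲⇒≤ p))) (≡⇒≅ (sym (Λ-natural g h)))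

module Substitution {c ℓ e : Level} (𝒞 : PosMonClosed c ℓ e) (⟦o⟧ : PosMonClosed.Obj 𝒞)
                    (Γ : List Ty) where
  open PosMonClosed 𝒞
  open Interp 𝒞 ⟦o⟧ Γ
  open Transport 𝒞
  open Monoidal 𝒞

  ⟦++⟧³ : ∀ A B C → ⟦ (A ++ B) ++ C ⟧ctx ≡ (⟦ A ⟧ctx ⊗₀ ⟦ B ⟧ctx) ⊗₀ ⟦ C ⟧ctx
  ⟦++⟧³ A B C = trans (⟦++⟧ (A ++ B) C) (cong (_⊗₀ ⟦ C ⟧ctx) (⟦++⟧ A B))

  ⟦ε++⟧ : ∀ A → ⟦ A ⟧ctx ≡ I ⊗₀ ⟦ ε ++ A ⟧ctx
  ⟦ε++⟧ A = trans (cong ⟦_⟧ctx (sym (++-identityˡ A))) (sym (unitˡ₀ _))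

  id-++ : ∀ A B → id {⟦ A ++ B ⟧ctx} ≅ id {⟦ A ⟧ctx} ⊗₁ id {⟦ B ⟧ctx}
  id-++ A B = ≅-trans (id-cong (⟦++⟧ A B)) (≅-sym ⊗-id-≅)

  weakening-map : ∀ A M B → Hom ⟦ (A ++ M) ++ B ⟧ctx ⟦ A ++ B ⟧ctx
  weakening-map A M B =
    cast (sym (⟦++⟧³ A M B)) (sym (⟦++⟧³ A ε B)) ((id ⊗₁ ⊥ ⟦ M ⟧ctx) ⊗₁ id)

  weakening-map-≅ : ∀ A M B →
                    weakening-map A M B ≅ (id {⟦ A ⟧ctx} ⊗₁ ⊥ ⟦ M ⟧ctx) ⊗₁ id {⟦ B ⟧ctx}
  weakening-map-≅ A M B = cast-≅ _ _ _

  module _ (⟦_⟧c : ∀ {τ} → τ ∈ Γ → Hom I ⟦ τ ⟧ty) where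
    open Terms ⟦_⟧c

    substitution-map : ∀ Δ Δ' {Δ'' τ} → Tm Γ Δ'' τ →
                       Hom ⟦ (Δ ++ Δ'') ++ Δ' ⟧ctx ⟦ (Δ ▸ τ) ++ Δ' ⟧ctx
    substitution-map Δ Δ' {Δ''} {τ} u =
      cast (sym (⟦++⟧³ Δ Δ'' Δ')) (sym (⟦++⟧ (Δ ▸ τ) Δ')) ((id ⊗₁ ⟦ u ⟧) ⊗₁ id)

    substitution-map-≅ : ∀ Δ Δ' {Δ'' τ} (u : Tm Γ Δ'' τ) →
                         substitution-map Δ Δ' u ≅ (id {⟦ Δ ⟧ctx} ⊗₁ ⟦ u ⟧) ⊗₁ id {⟦ Δ' ⟧ctx}
    substitution-map-≅ Δ Δ' u = cast-≅ _ _ _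

    castTm-≅ : ∀ {Θ Θ' σ} (p : Θ ≡ Θ') (t : Tm Γ Θ σ) → ⟦ castTm p t ⟧ ≅ ⟦ t ⟧
    castTm-≅ refl t = ≅-refl

    var-≲-var : ∀ {Θ' σ X Y Z W} (P' Q' : Ctx) (p : Θ' ≡ (P' ▸ σ) ++ Q') (P Q : Ctx)
                  {a : Hom X Y} {b : Hom Z W} (R : Hom ⟦ Θ' ⟧ctx ⟦ (P ▸ σ) ++ Q ⟧ctx) →
                ⟦ P' ⟧ctx ≡ X → ⟦ P ⟧ctx ≡ Y → ⟦ Q' ⟧ctx ≡ Z → ⟦ Q ⟧ctx ≡ W →
                R ≅ (a ⊗₁ id {⟦ σ ⟧ty}) ⊗₁ b →
                ⟦ var {Γ = Γ} P' Q' p ⟧ ≲ ⟦ var {Γ = Γ} P Q refl ⟧ ∘ R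
    var-≲-var P' Q' p P Q {a} {b} R refl refl refl refl R≅ = begin
      ⟦ var P' Q' p ⟧                          ≅⟨ cast-≅ _ _ _ ⟩
      (⊥ _ ⊗₁ id) ⊗₁ ⊥ _                       ≲⟨ ⊗-factor (⊗-factor (⊥-factor a) (idʳ-factor id))
                                                            (⊥-factor b) ⟩
      ((⊥ _ ⊗₁ id) ⊗₁ ⊥ _) ∘ ((a ⊗₁ id) ⊗₁ b)  ≅˘⟨ ∘-cong (cast-≅ _ _ _) R≅ ⟩
      ⟦ var P Q refl ⟧ ∘ R                     ∎
      where open ≲-Reasoning

    app-≲-app : ∀ {P P' Q Q' S S' T T' A B} {f' : Hom P' (A ⊸ B)} {g' : Hom Q' A}
                  {f : Hom P (A ⊸ B)} {g : Hom Q A} {a : Hom S P} {b : Hom T Q}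
                  {p : P' ⊗₀ Q' ≡ S'} {q : P ⊗₀ Q ≡ T'} {R : Hom S' T'} →
                f' ≲ f ∘ a → g' ≲ g ∘ b → R ≅ a ⊗₁ b →
                cast p refl (ev ∘ (f' ⊗₁ g')) ≲ cast q refl (ev ∘ (f ⊗₁ g)) ∘ R
    app-≲-app f'≲ g'≲ R≅ = ≅-≲-trans (cast-≅ _ _ _)
      (≲-≅-trans (∘-factor ev (⊗-factor f'≲ g'≲)) (∘-cong (≅-sym (cast-≅ _ _ _)) (≅-sym R≅)))

    wk-≲ : ∀ {Θ σ} (A B M : Ctx) (eq : Θ ≡ A ++ B) (t : Tm Γ Θ σ)
             (R : Hom ⟦ (A ++ M) ++ B ⟧ctx ⟦ Θ ⟧ctx) →
           R ≅ (id {⟦ A ⟧ctx} ⊗₁ ⊥ ⟦ M ⟧ctx) ⊗₁ id {⟦ B ⟧ctx} →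
           ⟦ wk A B M eq t ⟧ ≲ ⟦ t ⟧ ∘ R
    wk-≲ A B M eq (cst c) R _ = ∘-factor ⟦ c ⟧c (⊥-factor R)
    wk-≲ A B M eq (var Δ Δ' refl) R R≅ with split (Δ ▸ _) Δ' A B eq
    ... | inj₁ (ε , refl , refl) =
      var-≲-var Δ (M ++ (ε ++ Δ')) _ Δ Δ' R refl refl (⟦++⟧ M (ε ++ Δ')) (⟦ε++⟧ Δ')
        (≅-trans R≅ (≅-trans (⊗-cong (⊗-cong (≅-sym ⊗-id-≅) ≅-refl) ≅-refl) (assoc-≅ _ _ _)))
    ... | inj₁ (E ▸ ρ , refl , refl) =
      var-≲-var ((A ++ M) ++ E) Δ' _ (A ++ E) Δ' R (⟦++⟧³ A M E) (⟦++⟧³ A ε E) refl refl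
        (⊗-idʳ-split R≅ (⟦++⟧ (E ▸ ρ) Δ') (⊗-idʳ-assoc _))
    ... | inj₂ (E , refl , refl) =
      var-≲-var Δ ((E ++ M) ++ B) _ Δ (E ++ B) R refl refl (⟦++⟧³ E M B) (⟦++⟧³ E ε B)
        (≅-trans (⊗-idˡ-split R≅ (⟦++⟧ (Δ ▸ _) E) ≅-refl) (⊗-cong (≅-sym ⊗-id-≅) ≅-refl))
    wk-≲ A B M eq (lam t) R R≅ =
      Λ-factor (wk-≲ A (B ▸ _) M (cong (_▸ _) eq) t (R ⊗₁ id)
                  (≅-trans (⊗-cong R≅ ≅-refl) (⊗-idʳ-assoc _)))
    wk-≲ A B M eq (app Δ₁ Δ₂ refl t u) R R≅ with split Δ₁ Δ₂ A B eq
    ... | inj₁ (E , refl , refl) =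
      app-≲-app (wk-≲ A E M refl t _ (weakening-map-≅ A M E)) (idʳ-factor ⟦ u ⟧)
                (⊗-idʳ-split R≅ (⟦++⟧ E Δ₂) (weakening-map-≅ A M E))
    ... | inj₂ (E , refl , refl) =
      app-≲-app (idʳ-factor ⟦ t ⟧) (wk-≲ E B M refl u _ (weakening-map-≅ E M B))
                (⊗-idˡ-split R≅ (⟦++⟧ Δ₁ E) (weakening-map-≅ E M B))

    -- wk₂ first weakens on the left, landing in (ε ++ L) ++ Θ rather than L ++ Θ,
    -- so the second weakening map W₂ must be retyped to W₂' before composing.
    wk₂-≲ : ∀ {Θ σ} (L R : Ctx) (u : Tm Γ Θ σ) →
            ⟦ wk₂ L R u ⟧ ≲ (⊥ ⟦ L ⟧ctx ⊗₁ ⟦ u ⟧) ⊗₁ ⊥ ⟦ R ⟧ctx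
    wk₂-≲ {Θ} {σ} L R u = begin
      ⟦ wk₂ L R u ⟧
        ≲⟨ wk-≲ (L ++ Θ) ε R refl (castTm p s) W₂ (weakening-map-≅ (L ++ Θ) R ε) ⟩
      ⟦ castTm p s ⟧ ∘ W₂
        ≅⟨ ∘-cong (castTm-≅ p s) (≅-sym W₂'-≅W₂) ⟩
      ⟦ s ⟧ ∘ W₂'
        ≲⟨ ∘-mono-≲ (wk-≲ ε Θ L (sym (++-identityˡ Θ)) u W₁ W₁-≅) (W₂' ∎) ⟩
      (⟦ u ⟧ ∘ W₁) ∘ W₂'
        ≅⟨ ≡⇒≅ (∘-assoc _ _ _) ⟩
      ⟦ u ⟧ ∘ (W₁ ∘ W₂')
        ≅⟨ ∘-cong (≅-sym (≅-trans (⊗-cong (unitˡ-≅ _) ≅-refl) (unitʳ-≅ _))) W₁∘W₂'-≅ ⟩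
      ((id ⊗₁ ⟦ u ⟧) ⊗₁ id) ∘ ((⊥ _ ⊗₁ id) ⊗₁ ⊥ _)
        ≅⟨ ≡⇒≅ (trans (⊗₃-∘ _ _ _ _ _ _) (cong₂ _⊗₁_ (cong₂ _⊗₁_ (idˡ _) (idʳ _)) (idˡ _))) ⟩
      (⊥ ⟦ L ⟧ctx ⊗₁ ⟦ u ⟧) ⊗₁ ⊥ ⟦ R ⟧ctx
        ∎
      where
      open ≲-Reasoning

      p : (ε ++ L) ++ Θ ≡ L ++ Θ
      p = cong (_++ Θ) (++-identityˡ L)

      s : Tm Γ ((ε ++ L) ++ Θ) σ
      s = wk ε Θ L (sym (++-identityˡ Θ)) u

      W₁ : Hom ⟦ (ε ++ L) ++ Θ ⟧ctx ⟦ Θ ⟧ctx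
      W₁ = cast refl (cong ⟦_⟧ctx (++-identityˡ Θ)) (weakening-map ε L Θ)

      W₁-≅ : W₁ ≅ (id {I} ⊗₁ ⊥ ⟦ L ⟧ctx) ⊗₁ id {⟦ Θ ⟧ctx}
      W₁-≅ = ≅-trans (cast-≅ refl (cong ⟦_⟧ctx (++-identityˡ Θ)) _) (weakening-map-≅ ε L Θ)

      W₂ : Hom ⟦ (L ++ Θ) ++ R ⟧ctx ⟦ L ++ Θ ⟧ctx
      W₂ = weakening-map (L ++ Θ) R ε

      W₂' : Hom ⟦ (L ++ Θ) ++ R ⟧ctx ⟦ (ε ++ L) ++ Θ ⟧ctx
      W₂' = cast refl (cong ⟦_⟧ctx (sym p)) W₂

      W₂'-≅W₂ : W₂' ≅ W₂
      W₂'-≅W₂ = cast-≅ refl (cong ⟦_⟧ctx (sym p)) W₂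

      W₁∘W₂'-≅ : W₁ ∘ W₂' ≅ (⊥ ⟦ L ⟧ctx ⊗₁ id {⟦ Θ ⟧ctx}) ⊗₁ ⊥ ⟦ R ⟧ctx
      W₁∘W₂'-≅ = ≅-trans (∘-cong W₁-≅′ W₂'-≅′)
        (≡⇒≅ (trans (⊗₃-∘ _ _ _ _ _ _) (cong₂ _⊗₁_ (cong₂ _⊗₁_ (idʳ _) (idˡ _)) (idˡ _))))
        where
        W₁-≅′ : W₁ ≅ (⊥ ⟦ L ⟧ctx ⊗₁ id {⟦ Θ ⟧ctx}) ⊗₁ id {I}
        W₁-≅′ = ≅-trans W₁-≅ (≅-trans (⊗-cong (unitˡ-≅ _) ≅-refl) (≅-sym (unitʳ-≅ _)))

        W₂'-≅′ : W₂' ≅ (id {⟦ L ⟧ctx} ⊗₁ id {⟦ Θ ⟧ctx}) ⊗₁ ⊥ ⟦ R ⟧ctx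
        W₂'-≅′ = ≅-trans W₂'-≅W₂ (≅-trans (weakening-map-≅ (L ++ Θ) R ε)
                   (≅-trans (unitʳ-≅ _) (⊗-cong (id-++ L Θ) ≅-refl)))

    wk₂-≲-var : ∀ {Δ'' τ} (Δ D D' : Ctx) (u : Tm Γ Δ'' τ) → ⟦ D ⟧ctx ≡ ⟦ D' ⟧ctx →
                (R : Hom ⟦ (Δ ++ Δ'') ++ D ⟧ctx ⟦ (Δ ▸ τ) ++ D' ⟧ctx) →
                R ≅ (id {⟦ Δ ⟧ctx} ⊗₁ ⟦ u ⟧) ⊗₁ id {⟦ D ⟧ctx} →
                ⟦ wk₂ Δ D u ⟧ ≲ ⟦ var {Γ = Γ} Δ D' refl ⟧ ∘ R
    wk₂-≲-var Δ D D' u D≡D' R R≅ = begin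
      ⟦ wk₂ Δ D u ⟧
        ≲⟨ wk₂-≲ Δ D u ⟩
      (⊥ ⟦ Δ ⟧ctx ⊗₁ ⟦ u ⟧) ⊗₁ ⊥ ⟦ D ⟧ctx
        ≲⟨ ⊗-factor (⊗-factor (idʳ-factor _) (idˡ-factor ⟦ u ⟧)) (idʳ-factor _) ⟩
      ((⊥ ⟦ Δ ⟧ctx ⊗₁ id) ⊗₁ ⊥ ⟦ D ⟧ctx) ∘ ((id ⊗₁ ⟦ u ⟧) ⊗₁ id)
        ≅˘⟨ ∘-cong (≅-trans (cast-≅ _ _ _) (⊗-cong ≅-refl (⊥-cong (sym D≡D')))) R≅ ⟩
      ⟦ var Δ D' refl ⟧ ∘ R
        ∎
      where open ≲-Reasoning

    sub-≲ : ∀ {Θ σ τ Δ''} (Δ Δ' : Ctx) (eq : Θ ≡ (Δ ▸ τ) ++ Δ') (t : Tm Γ Θ σ)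
              (u : Tm Γ Δ'' τ) (R : Hom ⟦ (Δ ++ Δ'') ++ Δ' ⟧ctx ⟦ Θ ⟧ctx) →
            R ≅ (id {⟦ Δ ⟧ctx} ⊗₁ ⟦ u ⟧) ⊗₁ id {⟦ Δ' ⟧ctx} →
            ⟦ sub Δ Δ' eq t u ⟧ ≲ ⟦ t ⟧ ∘ R
    sub-≲ Δ Δ' eq (cst c) u R _ = ∘-factor ⟦ c ⟧c (⊥-factor R)
    sub-≲ {σ = σ} {τ} {Δ''} Δ Δ' eq (var Δ₁ Δ₂ refl) u R R≅
      with split (Δ₁ ▸ σ) Δ₂ (Δ ▸ τ) Δ' eq
    ... | inj₁ (ε , refl , refl) =
      wk₂-≲-var Δ (ε ++ Δ₂) Δ₂ u (cong ⟦_⟧ctx (++-identityˡ Δ₂)) R R≅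
    ... | inj₁ (E ▸ ρ , refl , refl) =
      var-≲-var ((Δ ++ Δ'') ++ E) Δ₂ _ ((Δ ▸ τ) ++ E) Δ₂ R
        (⟦++⟧³ Δ Δ'' E) (⟦++⟧ (Δ ▸ τ) E) refl refl
        (⊗-idʳ-split R≅ (⟦++⟧ (E ▸ ρ) Δ₂) (⊗-idʳ-assoc _))
    ... | inj₂ (ε , refl , refl) =
      wk₂-≲-var Δ Δ' (ε ++ Δ') u (cong ⟦_⟧ctx (sym (++-identityˡ Δ'))) R R≅
    ... | inj₂ (E ▸ ρ , refl , refl) =
      var-≲-var Δ₁ ((E ++ Δ'') ++ Δ') _ Δ₁ ((E ▸ ρ) ++ Δ') R
        refl refl (⟦++⟧³ E Δ'' Δ') (⟦++⟧ (E ▸ ρ) Δ')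
        (≅-trans (⊗-idˡ-split R≅ (⟦++⟧ (Δ₁ ▸ σ) E) ≅-refl) (⊗-cong (≅-sym ⊗-id-≅) ≅-refl))
    sub-≲ Δ Δ' eq (lam t) u R R≅ =
      Λ-factor (sub-≲ Δ (Δ' ▸ _) (cong (_▸ _) eq) t u (R ⊗₁ id)
                  (≅-trans (⊗-cong R≅ ≅-refl) (⊗-idʳ-assoc _)))
    sub-≲ {τ = τ} Δ Δ' eq (app Δ₁ Δ₂ refl t₁ t₂) u R R≅ with split Δ₁ Δ₂ (Δ ▸ τ) Δ' eq
    ... | inj₁ (E , refl , refl) =
      app-≲-app (sub-≲ Δ E refl t₁ u _ (substitution-map-≅ Δ E u)) (idʳ-factor ⟦ t₂ ⟧)
                (⊗-idʳ-split R≅ (⟦++⟧ E Δ₂) (substitution-map-≅ Δ E u))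
    ... | inj₂ (ε , refl , refl) =
      app-≲-app (sub-≲ Δ ε refl t₁ u _ (substitution-map-≅ Δ ε u)) (idʳ-factor ⟦ t₂ ⟧)
                (⊗-idʳ-split R≅ (⟦ε++⟧ Δ') (substitution-map-≅ Δ ε u))
    ... | inj₂ (E ▸ ρ , refl , refl) =
      app-≲-app (idʳ-factor ⟦ t₁ ⟧) (sub-≲ E Δ' refl t₂ u _ (substitution-map-≅ E Δ' u))
                (⊗-idˡ-split R≅ (⟦++⟧ Δ₁ E) (substitution-map-≅ E Δ' u))

lemma4p3 : ∀ {c ℓ e : Level} (𝒞 : PosMonClosed c ℓ e) (⟦o⟧ : PosMonClosed.Obj 𝒞)
             (Γ : List Ty) →
           let open PosMonClosed 𝒞
               open Interp 𝒞 ⟦o⟧ Γ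
           in (⟦_⟧c : ∀ {τ} → τ ∈ Γ → Hom I ⟦ τ ⟧ty) →
              let open Terms ⟦_⟧c
              in ∀ (Δ Δ' Δ'' : Ctx) {τ σ : Ty}
                   (t : Tm Γ ((Δ ▸ τ) ++ Δ') σ) (u : Tm Γ Δ'' τ) →
                 ⟦ sub Δ Δ' refl t u ⟧
                   ≤ cast (sym (trans (⟦++⟧ (Δ ++ Δ'') Δ')
                                      (cong (_⊗₀ ⟦ Δ' ⟧ctx) (⟦++⟧ Δ Δ''))))
                          refl
                          (⟦ t ⟧ ∘ cast refl (sym (⟦++⟧ (Δ ▸ τ) Δ'))
                                        ((id ⊗₁ ⟦ u ⟧) ⊗₁ id))
lemma4p3 𝒞 ⟦o⟧ Γ ⟦_⟧c Δ Δ' Δ'' t u = ≲⇒≤ (begin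
  ⟦ sub Δ Δ' refl t u ⟧
    ≲⟨ sub-≲ ⟦_⟧c Δ Δ' refl t u _ (substitution-map-≅ ⟦_⟧c Δ Δ' u) ⟩
  ⟦ t ⟧ ∘ substitution-map ⟦_⟧c Δ Δ' u
    ≅⟨ ∘-cong ≅-refl (≅-trans (substitution-map-≅ ⟦_⟧c Δ Δ' u) (≅-sym (cast-≅ _ _ _))) ⟩
  ⟦ t ⟧ ∘ cast refl _ ((id ⊗₁ ⟦ u ⟧) ⊗₁ id)
    ≅˘⟨ cast-≅ _ _ _ ⟩
  _ ∎)
  where
  open PosMonClosed 𝒞
  open Interp 𝒞 ⟦o⟧ Γ
  open Terms ⟦_⟧c
  open Transport 𝒞
  open ≲-Reasoning
  open Substitution 𝒞 ⟦o⟧ Γ
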